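{- Given $\mathbb{N}$-vectors ${\bf c}$ and ${\bf d}$ we have \[ \overleftarrow{\mathfrak{F}}_{{\bf c}}\cdot \overleftarrow{\mathfrak{F}}_{{\bf d}}=\sum_{L\in \mathrm{Sh}(W_{{\bf c}}, W_{{\bf d}})} \overleftarrow{\mathfrak{F}}(L), \] where $\mathrm{Sh}(W_{{\bf c}}, W_{{\bf d}})$ denotes the set of shuffles of $W_{{\bf c}}$ with the word obtained from $W_{{\bf d}}$ by replacing every letter $(i,j)$ by $(i,j+c_i)$.
   Context: Let $\overline{\mathbb{Z}}$ be the ordered alphabet with letters $(i,j)$, $i\in\mathbb{Z}$, $j\in\mathbb{Z}_+$, ordered lexicographically (so $i<(i,1)<(i,2)<\cdots<i+1$), and set $\mathrm{val}((i,j))=i$. For an injective word $W=a_1\cdots a_r$ in $\overline{\mathbb{Z}}$, the back stable slide is the series \[\overleftarrow{\mathfrak{F}}(W)=\sum x_{i_1}x_{i_2}\cdots x_{i_r},\] summed over integer sequences $i_1\geq i_2\geq\cdots\geq i_r$ (no lower bound, values in $\mathbb{Z}$) with $i_k>i_{k+1}$ whenever $a_k>a_{k+1}$, and $i_k\leq \mathrm{val}(a_k)$ for all $k$. An $\mathbb{N}$-vector is a sequence ${\bf c}=(c_i)_{i\in\mathbb{Z}}$ of nonnegative integers with finite support. Given ${\bf c}$, $W_{\bf c}$ is the word consisting of the letters $(i,j)$ with $1\le j\le c_i$, ordered by decreasing $i$ and, for fixed $i$, increasing $j$; and $\overleftarrow{\mathfrak{F}}_{\bf c}:=\overleftarrow{\mathfrak{F}}(W_{\bf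 c})$. A shuffle of two words is any word obtained by interleaving them while preserving the internal order of the letters of each word; the shift $j\mapsto j+c_i$ ensures the shuffles are injective words. -}

module Defs where

open import Data.Nat as ℕ using (ℕ; zero; suc; _∸_)
open import Data.Integer as ℤ using (ℤ; +_)
open import Data.Product using (_×_; _,_; proj₁; proj₂)
open import Data.List using (List; []; _∷_; [_]; _++_; map; concatMap; upTo; replicate; reverse)
open import Data.Nat.ListAction using (sum)
open import Data.Bool using (Bool; true; false; _∧_; _∨_; if_then_else_)
open import Relation.Nullary.Decidable using (⌊_⌋)
open import Relation.Binary.PropositionalEquality using (_≢_)

-- Letters of the alphabet Z-bar: (i , j) with i ∈ ℤ, j ∈ ℕ
-- (the words considered only use j ≥ 1), ordered lexicographically.
Letter : Set
Letter = ℤ × ℕ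

val : Letter → ℤ
val = proj₁

_>ᴸ_ : Letter → Letter → Bool
(i , j) >ᴸ (i' , j') = ⌊ i' ℤ.<? i ⌋ ∨ (⌊ i ℤ.≟ i' ⌋ ∧ ⌊ j' ℕ.<? j ⌋)

Word : Set
Word = List Letter

-- A monomial x_{i_1} ⋯ x_{i_r} is represented by its index sequence
-- i_1 ≥ i_2 ≥ ⋯ ≥ i_r (weakly decreasing list of integers).
Monomial : Set
Monomial = List ℤ

-- A formal power series in the variables x_i (i ∈ ℤ), given by its
-- coefficient on each monomial (only weakly decreasing lists are relevant).
Series : Set
Series = Monomial → ℕ

admissible : Word → Monomial → Bool
admissible [] [] = true
admissible (a ∷ []) (i ∷ []) = ⌊ i ℤ.≤? val a ⌋
admissible (a ∷ b ∷ w) (i ∷ i' ∷ is) =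
  ⌊ i ℤ.≤? val a ⌋ ∧ ⌊ i' ℤ.≤? i ⌋ ∧ (if a >ᴸ b then ⌊ i' ℤ.<? i ⌋ else true)
  ∧ admissible (b ∷ w) (i' ∷ is)
admissible _ _ = false

slide : Word → Series
slide W m = if admissible W m then 1 else 0

runs : List ℤ → List (ℤ × ℕ)
runs [] = []
runs (x ∷ xs) with runs xs
... | [] = (x , 1) ∷ []
... | (y , k) ∷ r = if ⌊ x ℤ.≟ y ⌋ then (y , suc k) ∷ r else (x , 1) ∷ (y , k) ∷ r

-- All ways to split a monomial (as a multiset, given by runs) into an
-- ordered pair of monomials, each listed exactly once.
splitsR : List (ℤ × ℕ) → List (Monomial × Monomial)
splitsR [] = [ ([] , []) ]
splitsR ((x , k) ∷ r) =
  concatMap (λ a → map (λ pq → (replicate a x ++ proj₁ pq , replicate (k ∸ a) x ++ proj₂ pq))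
                       (splitsR r))
            (upTo (suc k))

_⊛_ : Series → Series → Series
(f ⊛ g) m = sum (map (λ pq → f (proj₁ pq) ℕ.* g (proj₂ pq)) (splitsR (runs m)))

-- ℕ-vectors: finitely supported c : ℤ → ℕ, with an explicit window
-- [lo , lo + len) containing the support.
record NVec : Set where
  field
    c   : ℤ → ℕ
    lo  : ℤ
    len : ℕ
    support : ∀ i → c i ≢ 0 → (lo ℤ.≤ i) × (i ℤ.< lo ℤ.+ + len)

open NVec public

block : (ℤ → ℕ) → ℤ → Word
block f i = map (λ j → (i , suc j)) (upTo (f i))

Wvec : NVec → Word
Wvec v = concatMap (λ k → block (c v) (lo v ℤ.+ + k)) (reverse (upTo (len v)))

Fvec : NVec → Series
Fvec v = slide (Wvec v)

shiftBy : (ℤ → ℕ) → Word → Word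
shiftBy f = map (λ a → (proj₁ a , proj₂ a ℕ.+ f (proj₁ a)))

shuffles : Word → Word → List Word
shuffles [] v = [ v ]
shuffles (a ∷ u) [] = [ a ∷ u ]
shuffles (a ∷ u) (b ∷ v) = map (a ∷_) (shuffles u (b ∷ v)) ++ map (b ∷_) (shuffles (a ∷ u) v)

-- The monomial x_{i_1}⋯x_{i_r} is processed run by run, starting with the k copies of its largest
-- index x. A word carries x on its first a letters exactly when that prefix has no descents and all its
-- values are ≥ x (a plateau); the rest of the word then carries the smaller indices. In the product the
-- k copies are split as a + b = k between the two factors. In the shuffle sum the first k letters of a
-- shuffle must form a plateau, and since the two words share no letter such a prefix is the merge of a
-- plateau prefix of length a of the first word with one of length b of the second, so both sides reduce
-- to the same sum over a + b = k and induction on the runs concludes. Shifting the second word leaves its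
-- slide unchanged and makes the two words disjoint.
module Submission where

open import Defs
open import Data.Integer using (_≤_)
open import Data.List using (map)
open import Data.Nat.ListAction using (sum)
open import Data.List.Relation.Unary.Linked using (Linked)
open import Relation.Binary.PropositionalEquality using (_≡_)

open import Data.Bool using (Bool; true; false; _∧_; _∨_; not; if_then_else_)
open import Data.Bool.Properties using (∧-assoc; ∧-comm; ∧-zeroʳ; ∧-identityʳ; ∧-conicalˡ)
open import Data.Empty using (⊥-elim)
open import Data.Integer as ℤ using (ℤ)
import Data.Integer.Properties as ℤP
open import Data.List using (List; []; _∷_; _++_; concatMap; upTo; applyUpTo; replicate; reverse; take; drop)
open import Data.List.Properties using (map-++; map-∘; map-cong; map-cong-local; map-applyUpTo)
open import Data.List.Relation.Binary.Disjoint.Propositional using (Disjoint; contractₗ; contractᵣ)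
import Data.List.Relation.Binary.Disjoint.Propositional.Properties as Disjoint
open import Data.List.Relation.Binary.Permutation.Propositional using (_↭_; ↭-refl; ↭-trans)
import Data.List.Relation.Binary.Permutation.Propositional.Properties as ↭
open import Data.List.Relation.Unary.All as All using (All; []; _∷_)
import Data.List.Relation.Unary.All.Properties as All
open import Data.List.Relation.Unary.AllPairs using (AllPairs; []; _∷_)
import Data.List.Relation.Unary.Linked as Linked
open import Data.List.Relation.Unary.Linked.Properties using (Linked⇒AllPairs)
open import Data.List.Relation.Unary.Any using (here)
open import Data.Maybe using (Maybe; nothing; just)
open import Data.Nat as ℕ using (ℕ; zero; suc; _+_; _*_; _∸_; z≤n; s≤s)
import Data.Nat.Properties as ℕP
open import Algebra.Properties.CommutativeSemigroup ℕP.*-commutativeSemigroup using (interchange)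
open import Data.Nat.ListAction.Properties using (sum-++; sum-↭)
open import Data.Product using (_×_; _,_; proj₁; proj₂)
open import Data.Product.Relation.Binary.Lex.Strict using (×-Lex; ×-isStrictTotalOrder)
open import Data.Product.Relation.Binary.Pointwise.NonDependent using (Pointwise; ≡×≡⇒≡)
open import Function using (_∘_; flip; _on_)
open import Relation.Binary using (IsStrictTotalOrder; tri<; tri≈; tri>)
import Relation.Binary.Construct.Flip.EqAndOrd as Flip
open import Relation.Binary.PropositionalEquality using (refl; sym; trans; cong; cong₂; module ≡-Reasoning)
open import Relation.Nullary using (Dec; yes; no; ¬_; contradiction)
open import Relation.Nullary.Decidable using (⌊_⌋)
open import Relation.Nullary.Reflects using (Reflects; ofʸ; ofⁿ; _×-reflects_; _⊎-reflects_)

⟦_⟧ : Bool → ℕ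
⟦ b ⟧ = if b then 1 else 0

⟦∧⟧ : ∀ a b → ⟦ a ∧ b ⟧ ≡ ⟦ a ⟧ * ⟦ b ⟧
⟦∧⟧ true  b = sym (ℕP.*-identityˡ ⟦ b ⟧)
⟦∧⟧ false b = refl

⟦∧⟧-* : ∀ a b n → ⟦ a ∧ b ⟧ * n ≡ ⟦ a ⟧ * (⟦ b ⟧ * n)
⟦∧⟧-* true  b n = sym (ℕP.*-identityˡ (⟦ b ⟧ * n))
⟦∧⟧-* false b n = refl

guard-false : ∀ {a} b c n → a ≡ false → ⟦ (a ∧ b) ∧ c ⟧ * n ≡ 0
guard-false b c n refl = refl

guard-true : ∀ a b {c c'} n → (a ≡ true → c ≡ c') → ⟦ a ⟧ * (⟦ b ∧ c ⟧ * n) ≡ ⟦ (a ∧ b) ∧ c' ⟧ * n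
guard-true true  b n c≡c' = trans (ℕP.*-identityˡ _) (cong (λ t → ⟦ b ∧ t ⟧ * n) (c≡c' refl))
guard-true false b n _    = refl

⌊⌋-⇔ : ∀ {P Q : Set} → (P → Q) → (Q → P) → (P? : Dec P) (Q? : Dec Q) → ⌊ P? ⌋ ≡ ⌊ Q? ⌋
⌊⌋-⇔ P⇒Q Q⇒P (yes p)  (yes q)  = refl
⌊⌋-⇔ P⇒Q Q⇒P (yes p)  (no ¬q) = contradiction (P⇒Q p) ¬q
⌊⌋-⇔ P⇒Q Q⇒P (no ¬p) (yes q)  = contradiction (Q⇒P q) ¬p
⌊⌋-⇔ P⇒Q Q⇒P (no ¬p) (no ¬q) = refl

⌊⌋-true : ∀ {P : Set} (P? : Dec P) → P → ⌊ P? ⌋ ≡ true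
⌊⌋-true (yes _)  _ = refl
⌊⌋-true (no ¬p) p = contradiction p ¬p

⌊⌋-false : ∀ {P : Set} (P? : Dec P) → ¬ P → ⌊ P? ⌋ ≡ false
⌊⌋-false (yes p) ¬p = contradiction p ¬p
⌊⌋-false (no _)  _  = refl

⌊⌋-reflects : ∀ {P : Set} (P? : Dec P) → Reflects P ⌊ P? ⌋
⌊⌋-reflects (yes p)  = ofʸ p
⌊⌋-reflects (no ¬p) = ofⁿ ¬p

private
  variable
    A B : Set

sum-map-++ : ∀ (f : A → ℕ) xs ys → sum (map f (xs ++ ys)) ≡ sum (map f xs) + sum (map f ys)
sum-map-++ f xs ys = trans (cong sum (map-++ f xs ys)) (sum-++ (map f xs) (map f ys))

sum-map-*ˡ : ∀ n (f : A → ℕ) xs → sum (map (λ x → n * f x) xs) ≡ n * sum (map f xs)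
sum-map-*ˡ n f []       = sym (ℕP.*-zeroʳ n)
sum-map-*ˡ n f (x ∷ xs) = trans (cong (n * f x +_) (sum-map-*ˡ n f xs)) (sym (ℕP.*-distribˡ-+ n (f x) _))

sum-map-zero : ∀ {f : A → ℕ} → (∀ x → f x ≡ 0) → ∀ xs → sum (map f xs) ≡ 0
sum-map-zero f≡0 []       = refl
sum-map-zero f≡0 (x ∷ xs) = cong₂ _+_ (f≡0 x) (sum-map-zero f≡0 xs)

sum-map-concatMap : ∀ (f : B → ℕ) (g : A → List B) xs →
  sum (map f (concatMap g xs)) ≡ sum (map (λ x → sum (map f (g x))) xs)
sum-map-concatMap f g []       = refl
sum-map-concatMap f g (x ∷ xs) =
  trans (sum-map-++ f (g x) (concatMap g xs)) (cong (sum (map f (g x)) +_) (sum-map-concatMap f g xs))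

All-concatMap : ∀ {P : B → Set} {f : A → List B} → (∀ x → All P (f x)) → ∀ xs → All P (concatMap f xs)
All-concatMap Pf xs = All.concat⁺ (All.map⁺ (All.universal Pf xs))

sumAntidiagonal : ℕ → (ℕ → ℕ → ℕ) → ℕ
sumAntidiagonal zero    f = f 0 0
sumAntidiagonal (suc k) f = f 0 (suc k) + sumAntidiagonal k (f ∘ suc)

sumAntidiagonal-cong : ∀ k {f g : ℕ → ℕ → ℕ} → (∀ a b → f a b ≡ g a b) → sumAntidiagonal k f ≡ sumAntidiagonal k g
sumAntidiagonal-cong zero    f≡g = f≡g 0 0
sumAntidiagonal-cong (suc k) f≡g = cong₂ _+_ (f≡g 0 (suc k)) (sumAntidiagonal-cong k (f≡g ∘ suc))

sumAntidiagonal-*ˡ : ∀ k n f → n * sumAntidiagonal k f ≡ sumAntidiagonal k (λ a b → n * f a b)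
sumAntidiagonal-*ˡ zero    n f = refl
sumAntidiagonal-*ˡ (suc k) n f =
  trans (ℕP.*-distribˡ-+ n (f 0 (suc k)) _) (cong (n * f 0 (suc k) +_) (sumAntidiagonal-*ˡ k n (f ∘ suc)))

sumAntidiagonal-zero : ∀ k {f : ℕ → ℕ → ℕ} → (∀ a b → f a b ≡ 0) → sumAntidiagonal k f ≡ 0
sumAntidiagonal-zero k f≡0 = trans (sumAntidiagonal-cong k f≡0) (lemma k)
  where
  lemma : ∀ k → sumAntidiagonal k (λ _ _ → 0) ≡ 0
  lemma zero    = refl
  lemma (suc k) = lemma k

sumAntidiagonal-head : ∀ k {f : ℕ → ℕ → ℕ} → (∀ a b → f (suc a) b ≡ 0) → sumAntidiagonal k f ≡ f 0 k
sumAntidiagonal-head zero            _      = refl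
sumAntidiagonal-head (suc k) {f} tail≡0 =
  trans (cong (f 0 (suc k) +_) (sumAntidiagonal-zero k tail≡0)) (ℕP.+-identityʳ _)

sumAntidiagonal-last : ∀ k f → sumAntidiagonal (suc k) f ≡ sumAntidiagonal k (λ a b → f a (suc b)) + f (suc k) 0
sumAntidiagonal-last zero    f = refl
sumAntidiagonal-last (suc k) f =
  trans (cong (f 0 (suc (suc k)) +_) (sumAntidiagonal-last k (f ∘ suc))) (sym (ℕP.+-assoc (f 0 (suc (suc k))) _ _))

sumAntidiagonal-flip : ∀ k f → sumAntidiagonal k f ≡ sumAntidiagonal k (flip f)
sumAntidiagonal-flip zero    f = refl
sumAntidiagonal-flip (suc k) f = begin
    f 0 (suc k) + sumAntidiagonal k (f ∘ suc)
  ≡⟨ cong (f 0 (suc k) +_) (sumAntidiagonal-flip k (f ∘ suc)) ⟩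
    f 0 (suc k) + sumAntidiagonal k (flip (f ∘ suc))
  ≡⟨ ℕP.+-comm (f 0 (suc k)) _ ⟩
    sumAntidiagonal k (flip (f ∘ suc)) + f 0 (suc k)
  ≡⟨ sym (sumAntidiagonal-last k (flip f)) ⟩
    sumAntidiagonal (suc k) (flip f)
  ∎
  where open ≡-Reasoning

sumAntidiagonal-upTo : ∀ k f → sum (map (λ a → f a (k ∸ a)) (upTo (suc k))) ≡ sumAntidiagonal k f
sumAntidiagonal-upTo zero    f = ℕP.+-identityʳ (f 0 0)
sumAntidiagonal-upTo (suc k) f = cong (f 0 (suc k) +_) (trans (cong sum shift) (sumAntidiagonal-upTo k (f ∘ suc)))
  where
  g : ℕ → ℕ
  g a = f a (suc k ∸ a)
  shift : map g (applyUpTo suc (suc k)) ≡ map (g ∘ suc) (upTo (suc k))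
  shift = trans (map-applyUpTo suc g (suc k)) (sym (map-applyUpTo (λ a → a) (g ∘ suc) (suc k)))

shuffles-comm : ∀ u v → shuffles u v ↭ shuffles v u
shuffles-comm []      []      = ↭-refl
shuffles-comm []      (_ ∷ _) = ↭-refl
shuffles-comm (_ ∷ _) []      = ↭-refl
shuffles-comm (a ∷ u) (b ∷ v) =
  ↭-trans (↭.++⁺ (↭.map⁺ (a ∷_) (shuffles-comm u (b ∷ v))) (↭.map⁺ (b ∷_) (shuffles-comm (a ∷ u) v)))
          (↭.++-comm (map (a ∷_) (shuffles (b ∷ v) u)) (map (b ∷_) (shuffles v (a ∷ u))))

sum-shuffles-comm : ∀ (f : Word → ℕ) u v → sum (map f (shuffles u v)) ≡ sum (map f (shuffles v u))
sum-shuffles-comm f u v = sum-↭ (↭.map⁺ f (shuffles-comm u v))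

Disjoint-dropˡ : ∀ n {u v : Word} → Disjoint u v → Disjoint (drop n u) v
Disjoint-dropˡ zero               dj = dj
Disjoint-dropˡ (suc n) {[]}       dj = dj
Disjoint-dropˡ (suc n) {_ ∷ _}    dj = Disjoint-dropˡ n (contractₗ dj)

Disjoint-drop : ∀ a b {u v : Word} → Disjoint u v → Disjoint (drop a u) (drop b v)
Disjoint-drop a b dj = Disjoint.sym (Disjoint-dropˡ b (Disjoint.sym (Disjoint-dropˡ a dj)))

_≻_ : Letter → Letter → Set
_≻_ = ×-Lex _≡_ ℤ._>_ ℕ._>_

≻-isStrictTotalOrder : IsStrictTotalOrder (Pointwise _≡_ _≡_) _≻_
≻-isStrictTotalOrder = ×-isStrictTotalOrder (Flip.isStrictTotalOrder ℤP.<-isStrictTotalOrder)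
                                            (Flip.isStrictTotalOrder ℕP.<-isStrictTotalOrder)

module ≻ = IsStrictTotalOrder ≻-isStrictTotalOrder

>ᴸ-reflects : ∀ a b → Reflects (a ≻ b) (a >ᴸ b)
>ᴸ-reflects (i , j) (i' , j') =
  ⌊⌋-reflects (i' ℤ.<? i) ⊎-reflects (⌊⌋-reflects (i ℤ.≟ i') ×-reflects ⌊⌋-reflects (j' ℕ.<? j))

≻⇒>ᴸ : ∀ {a b} → a ≻ b → a >ᴸ b ≡ true
≻⇒>ᴸ {a} {b} a≻b with a >ᴸ b | >ᴸ-reflects a b
... | true  | _        = refl
... | false | ofⁿ a⊁b = ⊥-elim (a⊁b a≻b)

noDescent : Maybe Letter → Letter → Bool
noDescent nothing  c = true
noDescent (just q) c = not (q >ᴸ c)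

module _ {c d : Letter} (d≻c : d ≻ c) where

  noDescent-ascent : noDescent (just c) d ≡ true
  noDescent-ascent with c >ᴸ d | >ᴸ-reflects c d
  ... | false | _       = refl
  ... | true  | ofʸ c≻d = ⊥-elim (≻.asym d≻c c≻d)

  noDescent-descent : noDescent (just d) c ≡ false
  noDescent-descent = cong not (≻⇒>ᴸ d≻c)

  noDescent-trans : ∀ p → noDescent p c ≡ true → noDescent p d ≡ true
  noDescent-trans nothing  _   = refl
  noDescent-trans (just q) q⊁c with q >ᴸ d | >ᴸ-reflects q d
  ... | false | _       = refl
  ... | true  | ofʸ q≻d = contradiction (trans (sym q⊁c) (cong not (≻⇒>ᴸ (≻.trans q≻d d≻c)))) λ ()

>ᴸ-shiftBy : ∀ (f : ℤ → ℕ) (a b : Letter) →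
  (proj₁ a , proj₂ a + f (proj₁ a)) >ᴸ (proj₁ b , proj₂ b + f (proj₁ b)) ≡ a >ᴸ b
>ᴸ-shiftBy f (i , j) (i' , j') with i ℤ.≟ i'
... | yes refl = cong (⌊ i ℤ.<? i ⌋ ∨_)
  (⌊⌋-⇔ (ℕP.+-cancelʳ-< (f i) j' j) (ℕP.+-monoˡ-< (f i)) (j' + f i ℕ.<? j + f i) (j' ℕ.<? j))
... | no _     = refl

admissible-shiftBy : ∀ f w m → admissible (shiftBy f w) m ≡ admissible w m
admissible-shiftBy f []          m              = refl
admissible-shiftBy f (a ∷ [])    []             = refl
admissible-shiftBy f (a ∷ [])    (i ∷ [])       = refl
admissible-shiftBy f (a ∷ [])    (i ∷ _ ∷ _)    = refl
admissible-shiftBy f (a ∷ b ∷ w) []             = refl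
admissible-shiftBy f (a ∷ b ∷ w) (i ∷ [])       = refl
admissible-shiftBy f (a ∷ b ∷ w) (i ∷ i' ∷ m)   =
  cong₂ (λ descent rest → ⌊ i ℤ.≤? val a ⌋ ∧ ⌊ i' ℤ.≤? i ⌋ ∧ (if descent then ⌊ i' ℤ.<? i ⌋ else true) ∧ rest)
        (>ᴸ-shiftBy f a b) (admissible-shiftBy f (b ∷ w) (i' ∷ m))

slide-shiftBy : ∀ f w m → slide (shiftBy f w) m ≡ slide w m
slide-shiftBy f w m = cong ⟦_⟧ (admissible-shiftBy f w m)

fits : ℤ → Maybe Letter → Letter → Bool
fits x p c = noDescent p c ∧ ⌊ x ℤ.≤? val c ⌋

-- plateau x p n s: s has n letters, no descents (also from the preceding letter p) and all values ≥ x,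
-- i.e. s can carry the indices x,…,x after p.
plateau : ℤ → Maybe Letter → ℕ → Word → Bool
plateau x p zero    []      = true
plateau x p zero    (_ ∷ _) = false
plateau x p (suc n) []      = false
plateau x p (suc n) (c ∷ s) = fits x p c ∧ plateau x (just c) n s

plateau-rebase : ∀ x {q q' d} v b → noDescent q d ≡ noDescent q' d →
  plateau x q b (take b (d ∷ v)) ≡ plateau x q' b (take b (d ∷ v))
plateau-rebase x         v zero    _ = refl
plateau-rebase x {d = d} v (suc b) e = cong (λ t → (t ∧ ⌊ x ℤ.≤? val d ⌋) ∧ plateau x (just d) b (take b v)) e

admissible-∷-[] : ∀ a w → admissible (a ∷ w) [] ≡ false
admissible-∷-[] a []      = refl
admissible-∷-[] a (_ ∷ _) = refl

admissible-∷-plateau : ∀ {x p} → All (ℤ._< x) p → ∀ a c w →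
  admissible (c ∷ w) (replicate (suc a) x ++ p)
    ≡ ⌊ x ℤ.≤? val c ⌋ ∧ (plateau x (just c) a (take a w) ∧ admissible (drop a w) p)
admissible-∷-plateau {x} []      zero c []      = sym (∧-identityʳ ⌊ x ℤ.≤? val c ⌋)
admissible-∷-plateau {x} (_ ∷ _) zero c []      = sym (∧-zeroʳ ⌊ x ℤ.≤? val c ⌋)
admissible-∷-plateau {x} []      zero c (d ∷ w) =
  sym (trans (cong (⌊ x ℤ.≤? val c ⌋ ∧_) (admissible-∷-[] d w)) (∧-zeroʳ _))
admissible-∷-plateau {x} {y ∷ _} (y<x ∷ _) zero c (d ∷ w)
  rewrite ⌊⌋-true (y ℤ.≤? x) (ℤP.<⇒≤ y<x) | ⌊⌋-true (y ℤ.<? x) y<x with c >ᴸ d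
... | true  = refl
... | false = refl
admissible-∷-plateau {x} _ (suc a) c [] = sym (∧-zeroʳ ⌊ x ℤ.≤? val c ⌋)
admissible-∷-plateau {x} {p} p<x (suc a) c (d ∷ w)
  rewrite admissible-∷-plateau p<x a d w | ⌊⌋-true (x ℤ.≤? x) ℤP.≤-refl | ⌊⌋-false (x ℤ.<? x) (ℤP.<-irrefl refl)
  with c >ᴸ d
... | true  = refl
... | false = cong (⌊ x ℤ.≤? val c ⌋ ∧_)
                   (sym (∧-assoc ⌊ x ℤ.≤? val d ⌋ (plateau x (just d) a (take a w)) (admissible (drop a w) p)))

admissible-plateau-++ : ∀ {x p} → All (ℤ._< x) p → ∀ a w →
  admissible w (replicate a x ++ p) ≡ plateau x nothing a (take a w) ∧ admissible (drop a w) p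
admissible-plateau-++     _   zero    w       = refl
admissible-plateau-++     _   (suc a) []      = refl
admissible-plateau-++ {x} {p} p<x (suc a) (c ∷ w) =
  trans (admissible-∷-plateau p<x a c w)
        (sym (∧-assoc ⌊ x ℤ.≤? val c ⌋ (plateau x (just c) a (take a w)) (admissible (drop a w) p)))

slide-plateau-++ : ∀ {x p} → All (ℤ._< x) p → ∀ a w →
  slide w (replicate a x ++ p) ≡ ⟦ plateau x nothing a (take a w) ⟧ * slide (drop a w) p
slide-plateau-++ {x} {p} p<x a w =
  trans (cong ⟦_⟧ (admissible-plateau-++ p<x a w)) (⟦∧⟧ (plateau x nothing a (take a w)) (admissible (drop a w) p))

module PlateauShuffles (x : ℤ) (H : Word → ℕ) where

  shuffleSum : Word → Word → ℕ
  shuffleSum u v = sum (map H (shuffles u v))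

  prefixWeight : Maybe Letter → ℕ → Word → ℕ
  prefixWeight p k L = ⟦ plateau x p k (take k L) ⟧ * H (drop k L)

  prefixSum : Maybe Letter → ℕ → Word → Word → ℕ
  prefixSum p k u v = sum (map (prefixWeight p k) (shuffles u v))

  splitSummand : Maybe Letter → Word → Word → ℕ → ℕ → ℕ
  splitSummand p u v a b = ⟦ plateau x p a (take a u) ∧ plateau x p b (take b v) ⟧ * shuffleSum (drop a u) (drop b v)

  prefixSum-comm : ∀ p k u v → prefixSum p k u v ≡ prefixSum p k v u
  prefixSum-comm p k = sum-shuffles-comm (prefixWeight p k)

  splitSum-comm : ∀ p k u v → sumAntidiagonal k (splitSummand p u v) ≡ sumAntidiagonal k (splitSummand p v u)
  splitSum-comm p k u v = trans (sumAntidiagonal-flip k (splitSummand p u v)) (sumAntidiagonal-cong k swap)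
    where
    swap : ∀ a b → splitSummand p u v b a ≡ splitSummand p v u a b
    swap a b = cong₂ (λ t s → ⟦ t ⟧ * s) (∧-comm (plateau x p b (take b u)) (plateau x p a (take a v)))
                                          (sum-shuffles-comm H (drop b u) (drop a v))

  prefixSum-swap : ∀ p k u v → prefixSum p k v u ≡ sumAntidiagonal k (splitSummand p v u) →
    prefixSum p k u v ≡ sumAntidiagonal k (splitSummand p u v)
  prefixSum-swap p k u v e = trans (prefixSum-comm p k u v) (trans e (splitSum-comm p k v u))

  prefixSum-[]ˡ : ∀ p k v → prefixSum p k [] v ≡ sumAntidiagonal k (splitSummand p [] v)
  prefixSum-[]ˡ p k v = begin
      prefixWeight p k v + 0
    ≡⟨ ℕP.+-identityʳ _ ⟩
      ⟦ plateau x p k (take k v) ⟧ * H (drop k v)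
    ≡⟨ cong (⟦ plateau x p k (take k v) ⟧ *_) (sym (ℕP.+-identityʳ _)) ⟩
      splitSummand p [] v 0 k
    ≡⟨ sym (sumAntidiagonal-head k (λ _ _ → refl)) ⟩
      sumAntidiagonal k (splitSummand p [] v)
    ∎
    where open ≡-Reasoning

  prefixSum-∷∷ : ∀ p k c d u v → prefixSum p (suc k) (c ∷ u) (d ∷ v)
    ≡ ⟦ fits x p c ⟧ * prefixSum (just c) k u (d ∷ v) + ⟦ fits x p d ⟧ * prefixSum (just d) k (c ∷ u) v
  prefixSum-∷∷ p k c d u v =
    trans (sum-map-++ (prefixWeight p (suc k)) (map (c ∷_) (shuffles u (d ∷ v))) (map (d ∷_) (shuffles (c ∷ u) v)))
          (cong₂ _+_ (prefixSum-cons c (shuffles u (d ∷ v))) (prefixSum-cons d (shuffles (c ∷ u) v)))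
    where
    prefixSum-cons : ∀ e Ls → sum (map (prefixWeight p (suc k)) (map (e ∷_) Ls))
      ≡ ⟦ fits x p e ⟧ * sum (map (prefixWeight (just e) k) Ls)
    prefixSum-cons e Ls = begin
        sum (map (prefixWeight p (suc k)) (map (e ∷_) Ls))
      ≡⟨ cong sum (sym (map-∘ Ls)) ⟩
        sum (map (λ L → prefixWeight p (suc k) (e ∷ L)) Ls)
      ≡⟨ cong sum (map-cong (λ L → ⟦∧⟧-* (fits x p e) (plateau x (just e) k (take k L)) (H (drop k L))) Ls) ⟩
        sum (map (λ L → ⟦ fits x p e ⟧ * prefixWeight (just e) k L) Ls)
      ≡⟨ sum-map-*ˡ ⟦ fits x p e ⟧ (prefixWeight (just e) k) Ls ⟩
        ⟦ fits x p e ⟧ * sum (map (prefixWeight (just e) k) Ls)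
      ∎
      where open ≡-Reasoning

  module _ {k : ℕ} (ih : ∀ p u v → Disjoint u v → prefixSum p k u v ≡ sumAntidiagonal k (splitSummand p u v))
           {c d : Letter} (d≻c : d ≻ c) where

    -- A plateau starting with d cannot contain c, so after d only a = 0 survives; after c the
    -- plateau condition on the prefix of d ∷ v does not depend on whether c or p precedes it.
    prefixSum-ascending : ∀ p u v → Disjoint (c ∷ u) (d ∷ v) →
      prefixSum p (suc k) (c ∷ u) (d ∷ v) ≡ sumAntidiagonal (suc k) (splitSummand p (c ∷ u) (d ∷ v))
    prefixSum-ascending p u v dj = begin
        prefixSum p (suc k) (c ∷ u) (d ∷ v)
      ≡⟨ prefixSum-∷∷ p k c d u v ⟩
        ⟦ fits x p c ⟧ * prefixSum (just c) k u (d ∷ v) + ⟦ fits x p d ⟧ * prefixSum (just d) k (c ∷ u) v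
      ≡⟨ cong₂ (λ s t → ⟦ fits x p c ⟧ * s + ⟦ fits x p d ⟧ * t)
               (ih _ u (d ∷ v) (contractₗ dj)) (ih _ (c ∷ u) v (contractᵣ dj)) ⟩
        ⟦ fits x p c ⟧ * sumAntidiagonal k (splitSummand (just c) u (d ∷ v))
          + ⟦ fits x p d ⟧ * sumAntidiagonal k (splitSummand (just d) (c ∷ u) v)
      ≡⟨ cong₂ _+_ c-first d-first ⟩
        sumAntidiagonal k (splitSummand p (c ∷ u) (d ∷ v) ∘ suc) + splitSummand p (c ∷ u) (d ∷ v) 0 (suc k)
      ≡⟨ ℕP.+-comm (sumAntidiagonal k (splitSummand p (c ∷ u) (d ∷ v) ∘ suc)) _ ⟩
        sumAntidiagonal (suc k) (splitSummand p (c ∷ u) (d ∷ v))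
      ∎
      where
      open ≡-Reasoning

      c-first : ⟦ fits x p c ⟧ * sumAntidiagonal k (splitSummand (just c) u (d ∷ v))
              ≡ sumAntidiagonal k (splitSummand p (c ∷ u) (d ∷ v) ∘ suc)
      c-first = trans (sumAntidiagonal-*ˡ k ⟦ fits x p c ⟧ _) (sumAntidiagonal-cong k λ a b →
        guard-true (fits x p c) (plateau x (just c) a (take a u)) (shuffleSum (drop a u) (drop b (d ∷ v))) λ fits≡true →
          plateau-rebase x v b (trans (noDescent-ascent d≻c)
                                      (sym (noDescent-trans d≻c p (∧-conicalˡ (noDescent p c) _ fits≡true)))))

      d-first : ⟦ fits x p d ⟧ * sumAntidiagonal k (splitSummand (just d) (c ∷ u) v)
              ≡ splitSummand p (c ∷ u) (d ∷ v) 0 (suc k)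
      d-first = trans (cong (⟦ fits x p d ⟧ *_) (sumAntidiagonal-head k λ a b →
                         guard-false (plateau x (just c) a (take a u)) (plateau x (just d) b (take b v)) _
                                     (cong (_∧ ⌊ x ℤ.≤? val c ⌋) (noDescent-descent d≻c))))
                      (sym (⟦∧⟧-* (fits x p d) (plateau x (just d) k (take k v)) (shuffleSum (c ∷ u) (drop k v))))

  -- Both sides are symmetric in u and v, so it suffices to treat u starting with the smaller letter.
  prefixSum≡splitSum : ∀ k p u v → Disjoint u v → prefixSum p k u v ≡ sumAntidiagonal k (splitSummand p u v)
  prefixSum≡splitSum zero    p u       v       _  = sum-map-*ˡ 1 H (shuffles u v)
  prefixSum≡splitSum (suc k) p []      v       _  = prefixSum-[]ˡ p (suc k) v
  prefixSum≡splitSum (suc k) p (c ∷ u) []      _  =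
    prefixSum-swap p (suc k) (c ∷ u) [] (prefixSum-[]ˡ p (suc k) (c ∷ u))
  prefixSum≡splitSum (suc k) p (c ∷ u) (d ∷ v) dj with ≻.compare c d
  ... | tri< c≻d _ _ = prefixSum-swap p (suc k) (c ∷ u) (d ∷ v)
                         (prefixSum-ascending (prefixSum≡splitSum k) c≻d p v u (Disjoint.sym dj))
  ... | tri≈ _ c≈d _ = ⊥-elim (dj (here refl , here (≡×≡⇒≡ c≈d)))
  ... | tri> _ _ d≻c = prefixSum-ascending (prefixSum≡splitSum k) d≻c p u v dj

expandRuns : List (ℤ × ℕ) → Monomial
expandRuns = concatMap (λ r → replicate (proj₂ r) (proj₁ r))

expandRuns-All : ∀ {P : ℤ → Set} {R} → All (P ∘ proj₁) R → All P (expandRuns R)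
expandRuns-All []                         = []
expandRuns-All {R = (_ , l) ∷ _} (Py ∷ PR) = All.++⁺ (All.replicate⁺ l Py) (expandRuns-All PR)

splitsR-All : ∀ {P : ℤ → Set} R → All (P ∘ proj₁) R →
  All (λ pq → All P (proj₁ pq) × All P (proj₂ pq)) (splitsR R)
splitsR-All []            []        = ([] , []) ∷ []
splitsR-All ((_ , l) ∷ R) (Py ∷ PR) = All-concatMap (λ a → All.map⁺ (All.map (λ { (Pp , Pq) →
  All.++⁺ (All.replicate⁺ a Py) Pp , All.++⁺ (All.replicate⁺ (l ∸ a) Py) Pq }) (splitsR-All R PR))) (upTo (suc l))

runs-expand : ∀ m → expandRuns (runs m) ≡ m
runs-expand []       = refl
runs-expand (x ∷ xs) with runs xs | runs-expand xs
... | []          | e = cong (x ∷_) e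
... | (y , k) ∷ r | e with x ℤ.≟ y
...   | yes refl = cong (y ∷_) e
...   | no _     = cong (x ∷_) e

runs-positive : ∀ m → All (λ r → 0 ℕ.< proj₂ r) (runs m)
runs-positive []       = []
runs-positive (x ∷ xs) with runs xs | runs-positive xs
... | []          | _         = s≤s z≤n ∷ []
... | (y , k) ∷ r | 0<k ∷ 0<r with x ℤ.≟ y
...   | yes refl = s≤s z≤n ∷ 0<r
...   | no _     = s≤s z≤n ∷ 0<k ∷ 0<r

runs-descending : ∀ {m} → Linked (λ a b → b ≤ a) m → Linked (ℤ._>_ on proj₁) (runs m)
runs-descending {[]}     _  = Linked.[]
runs-descending {x ∷ xs} m↓ with runs xs | runs-expand xs | runs-positive xs | runs-descending (Linked.tail m↓)
... | []               | _ | _        | _  = Linked.[-]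
... | (y , zero)  ∷ r  | _ | () ∷ _   | _
... | (y , suc k) ∷ r  | e | _        | r↓ with x ℤ.≟ y
...   | yes refl = recount r↓
  where
  recount : ∀ {l} → Linked (ℤ._>_ on proj₁) ((y , l) ∷ r) → Linked (ℤ._>_ on proj₁) ((y , suc l) ∷ r)
  recount Linked.[-]        = Linked.[-]
  recount (y>z Linked.∷ r↓) = y>z Linked.∷ r↓
...   | no x≢y = ℤP.≤∧≢⇒< (head-≤ e m↓) (x≢y ∘ sym) Linked.∷ r↓
  where
  head-≤ : ∀ {ys} → y ∷ ys ≡ xs → Linked (λ a b → b ≤ a) (x ∷ xs) → y ≤ x
  head-≤ refl = Linked.head

slide-[]-shuffles : ∀ u v → slide u [] * slide v [] + 0 ≡ sum (map (λ L → slide L []) (shuffles u v))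
slide-[]-shuffles []      []      = refl
slide-[]-shuffles []      (b ∷ v) rewrite admissible-∷-[] b v = refl
slide-[]-shuffles (a ∷ u) []      rewrite admissible-∷-[] a u = refl
slide-[]-shuffles (a ∷ u) (b ∷ v) rewrite admissible-∷-[] a u = sym (begin
    sum (map (λ L → slide L []) (map (a ∷_) (shuffles u (b ∷ v)) ++ map (b ∷_) (shuffles (a ∷ u) v)))
  ≡⟨ sum-map-++ (λ L → slide L []) (map (a ∷_) (shuffles u (b ∷ v))) (map (b ∷_) (shuffles (a ∷ u) v)) ⟩
    sum (map (λ L → slide L []) (map (a ∷_) (shuffles u (b ∷ v))))
      + sum (map (λ L → slide L []) (map (b ∷_) (shuffles (a ∷ u) v)))
  ≡⟨ cong₂ _+_ (starting-with a (shuffles u (b ∷ v))) (starting-with b (shuffles (a ∷ u) v)) ⟩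
    0
  ∎)
  where
  open ≡-Reasoning
  starting-with : ∀ e Ls → sum (map (λ L → slide L []) (map (e ∷_) Ls)) ≡ 0
  starting-with e Ls = trans (cong sum (sym (map-∘ Ls))) (sum-map-zero (λ L → cong ⟦_⟧ (admissible-∷-[] e L)) Ls)

slide-splits : ∀ R → AllPairs (ℤ._>_ on proj₁) R → ∀ u v → Disjoint u v →
  sum (map (λ pq → slide u (proj₁ pq) * slide v (proj₂ pq)) (splitsR R))
    ≡ sum (map (λ L → slide L (expandRuns R)) (shuffles u v))
slide-splits []            _           u v _  = slide-[]-shuffles u v
slide-splits ((x , k) ∷ R) (R<x ∷ R↓) u v dj = begin
    sum (map φ (concatMap (λ a → map (ψ a) (splitsR R)) (upTo (suc k))))
  ≡⟨ sum-map-concatMap φ (λ a → map (ψ a) (splitsR R)) (upTo (suc k)) ⟩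
    sum (map (λ a → sum (map φ (map (ψ a) (splitsR R)))) (upTo (suc k)))
  ≡⟨ cong sum (map-cong split-at (upTo (suc k))) ⟩
    sum (map (λ a → splitSummand nothing u v a (k ∸ a)) (upTo (suc k)))
  ≡⟨ sumAntidiagonal-upTo k (splitSummand nothing u v) ⟩
    sumAntidiagonal k (splitSummand nothing u v)
  ≡⟨ sym (prefixSum≡splitSum k nothing u v dj) ⟩
    prefixSum nothing k u v
  ≡⟨ cong sum (map-cong (λ L → sym (slide-plateau-++ (expandRuns-All R<x) k L)) (shuffles u v)) ⟩
    sum (map (λ L → slide L (replicate k x ++ expandRuns R)) (shuffles u v))
  ∎
  where
  open ≡-Reasoning
  open PlateauShuffles x (λ L → slide L (expandRuns R))

  φ : Monomial × Monomial → ℕ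
  φ pq = slide u (proj₁ pq) * slide v (proj₂ pq)

  ψ : ℕ → Monomial × Monomial → Monomial × Monomial
  ψ a pq = replicate a x ++ proj₁ pq , replicate (k ∸ a) x ++ proj₂ pq

  split-at : ∀ a → sum (map φ (map (ψ a) (splitsR R))) ≡ splitSummand nothing u v a (k ∸ a)
  split-at a = begin
      sum (map φ (map (ψ a) (splitsR R)))
    ≡⟨ cong sum (sym (map-∘ (splitsR R))) ⟩
      sum (map (φ ∘ ψ a) (splitsR R))
    ≡⟨ cong sum (map-cong-local (All.map factor (splitsR-All R R<x))) ⟩
      sum (map (λ pq → ⟦ Pu ∧ Pv ⟧ * φ′ pq) (splitsR R))
    ≡⟨ sum-map-*ˡ ⟦ Pu ∧ Pv ⟧ φ′ (splitsR R) ⟩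
      ⟦ Pu ∧ Pv ⟧ * sum (map φ′ (splitsR R))
    ≡⟨ cong (⟦ Pu ∧ Pv ⟧ *_) (slide-splits R R↓ (drop a u) (drop b v) (Disjoint-drop a b dj)) ⟩
      splitSummand nothing u v a b
    ∎
    where
    b = k ∸ a
    Pu = plateau x nothing a (take a u)
    Pv = plateau x nothing b (take b v)
    φ′ : Monomial × Monomial → ℕ
    φ′ pq = slide (drop a u) (proj₁ pq) * slide (drop b v) (proj₂ pq)
    factor : ∀ {pq} → All (ℤ._< x) (proj₁ pq) × All (ℤ._< x) (proj₂ pq) → φ (ψ a pq) ≡ ⟦ Pu ∧ Pv ⟧ * φ′ pq
    factor {p , q} (p<x , q<x) = begin
        slide u (replicate a x ++ p) * slide v (replicate b x ++ q)
      ≡⟨ cong₂ _*_ (slide-plateau-++ p<x a u) (slide-plateau-++ q<x b v) ⟩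
        (⟦ Pu ⟧ * slide (drop a u) p) * (⟦ Pv ⟧ * slide (drop b v) q)
      ≡⟨ interchange ⟦ Pu ⟧ (slide (drop a u) p) ⟦ Pv ⟧ (slide (drop b v) q) ⟩
        (⟦ Pu ⟧ * ⟦ Pv ⟧) * φ′ (p , q)
      ≡⟨ cong (_* φ′ (p , q)) (sym (⟦∧⟧ Pu Pv)) ⟩
        ⟦ Pu ∧ Pv ⟧ * φ′ (p , q)
      ∎

slide-⊛ : ∀ u v → Disjoint u v → ∀ m → Linked (λ a b → b ≤ a) m →
  (slide u ⊛ slide v) m ≡ sum (map (λ L → slide L m) (shuffles u v))
slide-⊛ u v dj m m↓ = begin
    (slide u ⊛ slide v) m
  ≡⟨ slide-splits (runs m) (Linked⇒AllPairs (λ r>s s>t → ℤP.<-trans s>t r>s) (runs-descending m↓)) u v dj ⟩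
    sum (map (λ L → slide L (expandRuns (runs m))) (shuffles u v))
  ≡⟨ cong (λ m′ → sum (map (λ L → slide L m′) (shuffles u v))) (runs-expand m) ⟩
    sum (map (λ L → slide L m) (shuffles u v))
  ∎
  where open ≡-Reasoning

⊛-congʳ : ∀ f {g h : Series} → (∀ m → g m ≡ h m) → ∀ m → (f ⊛ g) m ≡ (f ⊛ h) m
⊛-congʳ f g≡h m = cong sum (map-cong (λ pq → cong (f (proj₁ pq) *_) (g≡h (proj₂ pq))) (splitsR (runs m)))

Wvec-All : ∀ {P : Letter → Set} w → (∀ i → All P (block (NVec.c w) i)) → All P (Wvec w)
Wvec-All w P-block = All-concatMap (λ k → P-block (NVec.lo w ℤ.+ ℤ.+ k)) (reverse (upTo (NVec.len w)))

block-bounded : ∀ f i → All (λ a → proj₂ a ℕ.≤ f (proj₁ a)) (block f i)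
block-bounded f i = All.map⁺ (All.all-upTo (f i))

block-positive : ∀ f i → All (λ a → 0 ℕ.< proj₂ a) (block f i)
block-positive f i = All.map⁺ (All.universal (λ _ → s≤s z≤n) (upTo (f i)))

Wvec-disjoint-shiftBy : ∀ c d → Disjoint (Wvec c) (shiftBy (NVec.c c) (Wvec d))
Wvec-disjoint-shiftBy c d (a∈Wc , a∈Wd′) = ℕP.<⇒≱ (All.lookup above a∈Wd′) (All.lookup below a∈Wc)
  where
  below : All (λ a → proj₂ a ℕ.≤ NVec.c c (proj₁ a)) (Wvec c)
  below = Wvec-All c (block-bounded (NVec.c c))
  above : All (λ a → NVec.c c (proj₁ a) ℕ.< proj₂ a) (shiftBy (NVec.c c) (Wvec d))
  above = All.map⁺ (All.map (ℕP.m<n+m _) (Wvec-All d (block-positive (NVec.c d))))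

proposition4p12 : (c d : NVec) (m : Monomial) → Linked (λ a b → b ≤ a) m →
    (Fvec c ⊛ Fvec d) m
      ≡ sum (map (λ L → slide L m) (shuffles (Wvec c) (shiftBy (NVec.c c) (Wvec d))))
proposition4p12 c d m m↓ = begin
    (Fvec c ⊛ Fvec d) m
  ≡⟨ ⊛-congʳ (Fvec c) (λ m′ → sym (slide-shiftBy (NVec.c c) (Wvec d) m′)) m ⟩
    (slide (Wvec c) ⊛ slide (shiftBy (NVec.c c) (Wvec d))) m
  ≡⟨ slide-⊛ (Wvec c) (shiftBy (NVec.c c) (Wvec d)) (Wvec-disjoint-shiftBy c d) m m↓ ⟩
    sum (map (λ L → slide L m) (shuffles (Wvec c) (shiftBy (NVec.c c) (Wvec d))))
  ∎
  where open ≡-Reasoning
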